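{- Let $G$ be a graph containing a complete subgraph $K$ isomorphic to $K_4$. If there is a path in $G\setminus E(K)$ (the graph obtained from $G$ by deleting the six edges of $K$) connecting two distinct vertices of $K$, then $\overline{\kappa}_3(G)\geq 3$.
   Context: All graphs are finite, simple and undirected. For a graph $G$ and $S\subseteq V(G)$ with $|S|\ge 2$, an $S$-tree (Steiner tree connecting $S$) is a subgraph of $G$ that is a tree containing all vertices of $S$. Two $S$-trees $T,T'$ are internally disjoint if $E(T)\cap E(T')=\varnothing$ and $V(T)\cap V(T')=S$. $\kappa_G(S)$ denotes the maximum number of pairwise internally disjoint $S$-trees in $G$, and $\overline{\kappa}_3(G)=\max\{\kappa_G(S): S\subseteq V(G),\ |S|=3\}$. -}

module Defs where

open import Level using (0ℓ)
open import Data.Nat using (ℕ)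
open import Data.Fin using (Fin)
open import Data.List using (List; []; _∷_; _++_)
open import Data.List.Relation.Unary.Unique.Propositional using (Unique)
open import Data.Product using (Σ; _×_; _,_; ∃; ∃-syntax)
open import Data.Sum using (_⊎_)
open import Data.Unit using (⊤)
open import Data.Empty using (⊥)
open import Relation.Nullary using (¬_)
open import Relation.Binary.PropositionalEquality using (_≡_; _≢_)

record Graph : Set₁ where
  field
    n     : ℕ
    Adj   : Fin n → Fin n → Set
    sym   : ∀ {x y} → Adj x y → Adj y x
    irrefl : ∀ {x} → ¬ Adj x x
open Graph public

module _ {n : ℕ} (R : Fin n → Fin n → Set) where

  data Walk : Fin n → Fin n → Set where
    []  : ∀ {u} → Walk u u
    _∷_ : ∀ {u v w} → R u v → Walk v w → Walk u w

  walkVerts : ∀ {u v} → Walk u v → List (Fin n)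
  walkVerts {u} [] = u ∷ []
  walkVerts {u} (_ ∷ p) = u ∷ walkVerts p

  Path : Fin n → Fin n → Set
  Path u v = Σ (Walk u v) λ p → Unique (walkVerts p)

  data Chain : List (Fin n) → Set where
    nil  : Chain []
    one  : ∀ {x} → Chain (x ∷ [])
    cons : ∀ {x y xs} → R x y → Chain (y ∷ xs) → Chain (x ∷ y ∷ xs)

  Cycle : Set
  Cycle = Σ (Fin n) λ a → Σ (Fin n) λ b → Σ (Fin n) λ c → Σ (List (Fin n)) λ rest →
            Unique (a ∷ b ∷ c ∷ rest) × Chain (a ∷ b ∷ c ∷ rest ++ a ∷ [])

record Subgraph (G : Graph) : Set₁ where
  field
    V     : Fin (n G) → Set
    E     : Fin (n G) → Fin (n G) → Set
    E-sym : ∀ {x y} → E x y → E y x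
    E⊆G   : ∀ {x y} → E x y → Adj G x y
    E-V   : ∀ {x y} → E x y → V x × V y
open Subgraph public

record IsTree {G : Graph} (T : Subgraph G) : Set where
  field
    connected : ∀ {u v} → V T u → V T v → Walk (E T) u v
    acyclic   : ¬ Cycle (E T)

record STree (G : Graph) (S : Fin (n G) → Set) : Set₁ where
  field
    tree   : Subgraph G
    isTree : IsTree tree
    S⊆V    : ∀ {x} → S x → V tree x
open STree public

-- internally disjoint: no common edge, and common vertices are exactly S
-- (S ⊆ V(T) ∩ V(T') holds automatically for S-trees).
InternallyDisjoint : {G : Graph} {S : Fin (n G) → Set} → STree G S → STree G S → Set
InternallyDisjoint {G} {S} T T' =
  (∀ {x y} → E (tree T) x y → E (tree T') x y → ⊥) ×
  (∀ {x} → V (tree T) x → V (tree T') x → S x)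

Three : {m : ℕ} → Fin m → Fin m → Fin m → Fin m → Set
Three a b c x = x ≡ a ⊎ x ≡ b ⊎ x ≡ c

κ≥ : (G : Graph) (S : Fin (n G) → Set) (k : ℕ) → Set₁
κ≥ G S k = Σ (Fin k → STree G S) λ T →
             ∀ i j → i ≢ j → InternallyDisjoint (T i) (T j)

κ̄₃≥ : (G : Graph) (k : ℕ) → Set₁
κ̄₃≥ G k = Σ (Fin (n G)) λ a → Σ (Fin (n G)) λ b → Σ (Fin (n G)) λ c →
             a ≢ b × a ≢ c × b ≢ c × κ≥ G (Three a b c) k

IsK4 : (G : Graph) → Fin (n G) → Fin (n G) → Fin (n G) → Fin (n G) → Set
IsK4 G a b c d =
  (a ≢ b × a ≢ c × a ≢ d × b ≢ c × b ≢ d × c ≢ d) ×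
  (Adj G a b × Adj G a c × Adj G a d × Adj G b c × Adj G b d × Adj G c d)

InFour : {m : ℕ} → Fin m → Fin m → Fin m → Fin m → Fin m → Set
InFour a b c d x = x ≡ a ⊎ x ≡ b ⊎ x ≡ c ⊎ x ≡ d

AdjMinusK : (G : Graph) → Fin (n G) → Fin (n G) → Fin (n G) → Fin (n G) →
            Fin (n G) → Fin (n G) → Set
AdjMinusK G a b c d x y = Adj G x y × ¬ (InFour a b c d x × InFour a b c d y)

module Submission where

-- Let q be the first vertex of K after u on the given path and r, s the two remaining
-- vertices of K, so that the segment from u to q meets K only in its ends.  For
-- S = {u, q, r} three internally disjoint S-trees are: the star at q with leaves u and r;
-- the star at s with leaves u, q and r; and the edge r u followed by the segment from u
-- to q.  The third tree avoids s, and apart from r u all its edges lie outside E(K).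

open import Defs
open import Level using (0ℓ)
open import Data.Nat using (ℕ; suc; _<_; _>_)
open import Data.Nat.Properties using (suc-injective; ≤-reflexive; <-trans; <-irrefl; <-asym)
open import Data.Fin using (Fin; zero; suc)
open import Data.Fin.Properties using (_≟_)
open import Data.List using (List; []; _∷_; _++_)
open import Data.List.Membership.Propositional using (_∈_; _∉_; lose)
open import Data.List.Membership.Propositional.Properties using (∈-++⁺ʳ)
open import Data.List.Relation.Unary.All as All using (All; []; _∷_)
open import Data.List.Relation.Unary.All.Properties using (¬Any⇒All¬)
open import Data.List.Relation.Unary.Any as Any using (Any; here; there)
open import Data.List.Relation.Unary.AllPairs using ([]; _∷_)
open import Data.List.Relation.Unary.Linked as Linked using (Linked; []; [-]; _∷_)
open import Data.List.Relation.Unary.Linked.Properties using (Linked⇒AllPairs)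
open import Data.List.Relation.Unary.Unique.Propositional using (Unique)
open import Data.List.Relation.Binary.Sublist.Propositional using (_⊆_; []; _∷_; _∷ʳ_; minimum)
open import Data.List.Relation.Binary.Sublist.Propositional.Properties using (All-resp-⊆)
open import Data.Product as Product using (∃₂; _×_; _,_; proj₁; proj₂)
open import Data.Sum as Sum using (_⊎_; inj₁; inj₂)
open import Data.Unit using (⊤; tt)
open import Data.Empty using (⊥; ⊥-elim)
open import Function using (_∘_; _on_)
open import Relation.Binary using (Rel; Symmetric; Transitive)
open import Relation.Binary.PropositionalEquality as ≡ using (_≡_; _≢_; refl; cong; ≢-sym; module ≡-Reasoning)
open import Relation.Nullary using (¬_; yes; no)
open import Relation.Nullary.Decidable using (_⊎-dec_)
open import Relation.Unary using (Pred; Decidable)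

private
  variable
    m : ℕ
    A : Set

module _ {R : Rel (Fin m) 0ℓ} where

  _++ʷ_ : ∀ {u v w} → Walk R u v → Walk R v w → Walk R u w
  []      ++ʷ q = q
  (e ∷ p) ++ʷ q = e ∷ (p ++ʷ q)

  reverseʷ : Symmetric R → ∀ {u v} → Walk R u v → Walk R v u
  reverseʷ R-sym []      = []
  reverseʷ R-sym (e ∷ p) = reverseʷ R-sym p ++ʷ (R-sym e ∷ [])

  connected-via-root : Symmetric R → {P : Pred (Fin m) 0ℓ} {root : Fin m} →
                       (∀ {x} → P x → Walk R root x) →
                       ∀ {u v} → P u → P v → Walk R u v
  connected-via-root R-sym reach Pu Pv = reverseʷ R-sym (reach Pu) ++ʷ reach Pv

  Walk⇒Linked : ∀ {u v} (w : Walk R u v) → Linked R (walkVerts R w)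
  Walk⇒Linked []          = [-]
  Walk⇒Linked (e ∷ [])    = e ∷ [-]
  Walk⇒Linked (e ∷ f ∷ w) = e ∷ Walk⇒Linked (f ∷ w)

  target∈walkVerts : ∀ {u v} (w : Walk R u v) → v ∈ walkVerts R w
  target∈walkVerts []      = here refl
  target∈walkVerts (_ ∷ w) = there (target∈walkVerts w)

  Chain⇒Linked : ∀ {xs} → Chain R xs → Linked R xs
  Chain⇒Linked nil        = []
  Chain⇒Linked one        = [-]
  Chain⇒Linked (cons e c) = e ∷ Chain⇒Linked c

mapʷ : {R S : Rel (Fin m) 0ℓ} → (∀ {x y} → R x y → S x y) → ∀ {u v} → Walk R u v → Walk S u v
mapʷ f []      = []
mapʷ f (e ∷ p) = f e ∷ mapʷ f p

Linked-snoc : ∀ {R : Rel A 0ℓ} {x y z} xs → Linked R (x ∷ xs ++ y ∷ []) → R y z →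
              Linked R (x ∷ xs ++ y ∷ z ∷ [])
Linked-snoc []       (xy ∷ [-]) yz = xy ∷ yz ∷ [-]
Linked-snoc (_ ∷ xs) (xw ∷ l)   yz = xw ∷ Linked-snoc xs l yz

Linked-head-related : ∀ {R : Rel A 0ℓ} {x y xs} → Transitive R → Linked R (x ∷ xs) → y ∈ xs → R x y
Linked-head-related trans l y∈ with Linked⇒AllPairs trans l
... | x≺ ∷ _ = All.lookup x≺ y∈

Unique-resp-⊆ : ∀ {xs ys : List A} → ys ⊆ xs → Unique xs → Unique ys
Unique-resp-⊆ []          []        = []
Unique-resp-⊆ (_ ∷ʳ sub)  (_ ∷ u)   = Unique-resp-⊆ sub u
Unique-resp-⊆ (refl ∷ sub) (x∉ ∷ u) = All-resp-⊆ sub x∉ ∷ Unique-resp-⊆ sub u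

-- Heights change by one along every edge and each vertex has at most one lower neighbour,
-- so a non-backtracking walk that goes up once keeps going up, and one whose last step
-- goes down went down all along.  Running once around a cycle and one step further gives
-- a non-backtracking walk revisiting its first vertex, which is impossible in both cases.
module Graded {R : Rel (Fin m) 0ℓ} (R-sym : Symmetric R) (h : Fin m → ℕ)
  (graded : ∀ {x y} → R x y → suc (h x) ≡ h y ⊎ suc (h y) ≡ h x)
  (lower-unique : ∀ {x y z} → R x z → R y z → suc (h x) ≡ h z → suc (h y) ≡ h z → x ≡ y)
  where

  private
    NonBacktracking : List (Fin m) → Set
    NonBacktracking (x ∷ y ∷ z ∷ zs) = x ≢ z × NonBacktracking (y ∷ z ∷ zs)
    NonBacktracking _                = ⊤

    EndsDescending : List (Fin m) → Set
    EndsDescending (x ∷ y ∷ [])     = suc (h y) ≡ h x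
    EndsDescending (_ ∷ y ∷ z ∷ zs) = EndsDescending (y ∷ z ∷ zs)
    EndsDescending _                = ⊥

    ascending : ∀ {x y zs} → Linked R (x ∷ y ∷ zs) → NonBacktracking (x ∷ y ∷ zs) →
                suc (h x) ≡ h y → Linked (_<_ on h) (x ∷ y ∷ zs)
    ascending (_ ∷ [-]) _ up = ≤-reflexive up ∷ [-]
    ascending (xy ∷ yz ∷ l) (x≢z , nb) up with graded yz
    ... | inj₁ up′  = ≤-reflexive up ∷ ascending (yz ∷ l) nb up′
    ... | inj₂ down = ⊥-elim (x≢z (lower-unique xy (R-sym yz) up down))

    descending : ∀ {x y zs} → Linked R (x ∷ y ∷ zs) → NonBacktracking (x ∷ y ∷ zs) →
                 EndsDescending (x ∷ y ∷ zs) → Linked (_>_ on h) (x ∷ y ∷ zs)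
    descending (_ ∷ [-]) _ down = ≤-reflexive down ∷ [-]
    descending (xy ∷ l@(_ ∷ _)) (x≢z , nb) end with graded xy | descending l nb end
    ... | inj₂ down | ih = ≤-reflexive down ∷ ih
    ... | inj₁ up   | y>z ∷ _ with ascending (xy ∷ l) (x≢z , nb) up
    ...   | _ ∷ y<z ∷ _ = ⊥-elim (<-asym y<z y>z)

    ends-descending : ∀ xs {y z} → suc (h z) ≡ h y → EndsDescending (xs ++ y ∷ z ∷ [])
    ends-descending []               down = down
    ends-descending (_ ∷ [])         down = down
    ends-descending (_ ∷ x ∷ [])     down = down
    ends-descending (_ ∷ x ∷ y ∷ xs) down = ends-descending (x ∷ y ∷ xs) down

    wrap-nonBacktracking : ∀ {x y ys a b} → Unique (x ∷ y ∷ ys) →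
                           All (a ≢_) (x ∷ y ∷ ys) → All (b ≢_) (y ∷ ys) →
                           NonBacktracking (x ∷ y ∷ ys ++ a ∷ b ∷ [])
    wrap-nonBacktracking {ys = []} _ (a≢x ∷ _) (b≢y ∷ []) = ≢-sym a≢x , ≢-sym b≢y , tt
    wrap-nonBacktracking {ys = _ ∷ _} ((_ ∷ x≢z ∷ _) ∷ u) (_ ∷ a∉) (_ ∷ b∉) =
      x≢z , wrap-nonBacktracking u a∉ b∉

  acyclic : ¬ Cycle R
  acyclic (a , b , c , rest , (a≢b ∷ a≢c ∷ a∉) ∷ uniq@(b∉ ∷ _) , cycle@(cons ab _)) =
    either-way (graded ab)
    where
    walk : Linked R (a ∷ b ∷ c ∷ rest ++ a ∷ b ∷ [])
    walk = Linked-snoc (b ∷ c ∷ rest) (Chain⇒Linked cycle) ab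
    nb : NonBacktracking (a ∷ b ∷ c ∷ rest ++ a ∷ b ∷ [])
    nb = a≢c , wrap-nonBacktracking uniq (a≢b ∷ a≢c ∷ a∉) b∉
    a∈ : a ∈ b ∷ c ∷ rest ++ a ∷ b ∷ []
    a∈ = there (there (∈-++⁺ʳ rest (here refl)))
    either-way : suc (h a) ≡ h b ⊎ suc (h b) ≡ h a → ⊥
    either-way (inj₁ up)   = <-irrefl refl (Linked-head-related <-trans (ascending walk nb up) a∈)
    either-way (inj₂ down) = <-irrefl refl (Linked-head-related (λ p q → <-trans q p)
      (descending walk nb (ends-descending (a ∷ b ∷ c ∷ rest) down)) a∈)

data Consecutive {A : Set} : List A → A → A → Set where
  here  : ∀ {x y zs}   → Consecutive (x ∷ y ∷ zs) x y
  there : ∀ {x y z zs} → Consecutive zs x y → Consecutive (z ∷ zs) x y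

Consecutive⇒∈ : ∀ {xs} {x y : A} → Consecutive xs x y → x ∈ xs × y ∈ xs
Consecutive⇒∈ here      = here refl , there (here refl)
Consecutive⇒∈ (there c) = Product.map there there (Consecutive⇒∈ c)

Neighbours : List A → A → A → Set
Neighbours xs x y = Consecutive xs x y ⊎ Consecutive xs y x

walk-from-head : ∀ {x : Fin m} {xs v} → v ∈ x ∷ xs → Walk (Neighbours (x ∷ xs)) x v
walk-from-head (here refl)            = []
walk-from-head {xs = []}    (there ())
walk-from-head {xs = _ ∷ _} (there v∈) = inj₁ here ∷ mapʷ (Sum.map there there) (walk-from-head v∈)

Linked-Consecutive : ∀ {R : Rel A 0ℓ} {xs x y} → Linked R xs → Consecutive xs x y → R x y
Linked-Consecutive (xy ∷ _) here      = xy
Linked-Consecutive (_ ∷ l)  (there c) = Linked-Consecutive l c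

position : List (Fin m) → Fin m → ℕ
position []       _ = 0
position (y ∷ ys) x with x ≟ y
... | yes _ = 0
... | no _  = suc (position ys x)

position-head : ∀ (x : Fin m) xs → position (x ∷ xs) x ≡ 0
position-head x xs with x ≟ x
... | yes _  = refl
... | no x≢x = ⊥-elim (x≢x refl)

position-tail : ∀ {x y : Fin m} xs → y ≢ x → position (x ∷ xs) y ≡ suc (position xs y)
position-tail {x = x} {y} xs y≢x with y ≟ x
... | yes y≡x = ⊥-elim (y≢x y≡x)
... | no _    = refl

position-Consecutive : ∀ {xs} {x y : Fin m} → Unique xs → Consecutive xs x y →
                       suc (position xs x) ≡ position xs y
position-Consecutive {xs = x ∷ y ∷ zs} ((x≢y ∷ _) ∷ _) here = begin
  suc (position (x ∷ y ∷ zs) x) ≡⟨ cong suc (position-head x (y ∷ zs)) ⟩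
  1                             ≡⟨ cong suc (≡.sym (position-head y zs)) ⟩
  suc (position (y ∷ zs) y)     ≡⟨ ≡.sym (position-tail (y ∷ zs) (≢-sym x≢y)) ⟩
  position (x ∷ y ∷ zs) y       ∎
  where open ≡-Reasoning
position-Consecutive {xs = z ∷ zs} {x} {y} (z∉ ∷ u) (there c) = begin
  suc (position (z ∷ zs) x)  ≡⟨ cong suc (position-tail zs (z≢ x∈)) ⟩
  suc (suc (position zs x))  ≡⟨ cong suc (position-Consecutive u c) ⟩
  suc (position zs y)        ≡⟨ ≡.sym (position-tail zs (z≢ y∈)) ⟩
  position (z ∷ zs) y        ∎
  where
  open ≡-Reasoning
  x∈ = proj₁ (Consecutive⇒∈ c)
  y∈ = proj₂ (Consecutive⇒∈ c)
  z≢ : ∀ {w} → w ∈ zs → w ≢ z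
  z≢ w∈ = ≢-sym (All.lookup z∉ w∈)

position-injective : ∀ {xs} {x y : Fin m} → x ∈ xs → y ∈ xs → position xs x ≡ position xs y → x ≡ y
position-injective {xs = z ∷ zs} {x} {y} x∈ y∈ eq with x ≟ z | y ≟ z
... | yes x≡z | yes y≡z = ≡.trans x≡z (≡.sym y≡z)
... | no x≢z  | no y≢z  = position-injective (Any.tail x≢z x∈) (Any.tail y≢z y∈) (suc-injective eq)
position-injective _ _ () | yes _ | no _
position-injective _ _ () | no _  | yes _

firstHit : ∀ {R : Rel A 0ℓ} {P : Pred A 0ℓ} {x xs} → Decidable P → Linked R (x ∷ xs) → Any P xs →
           ∃₂ λ ys y → Linked R (x ∷ ys) × ys ⊆ xs × y ∈ ys × P y × All (λ z → P z → z ≡ y) ys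
firstHit {xs = z ∷ zs} P? (xz ∷ l) hit with P? z
... | yes Pz  = z ∷ [] , z , xz ∷ [-] , refl ∷ minimum zs , here refl , Pz , (λ _ → refl) ∷ []
... | no ¬Pz with firstHit P? l (Any.tail ¬Pz hit)
...   | ys , y , l′ , ys⊆ , y∈ , Py , only-y =
  z ∷ ys , y , xz ∷ l′ , refl ∷ ys⊆ , there y∈ , Py , (⊥-elim ∘ ¬Pz) ∷ only-y

InFour? : (a b c d : Fin m) → Decidable (InFour a b c d)
InFour? a b c d x = x ≟ a ⊎-dec x ≟ b ⊎-dec x ≟ c ⊎-dec x ≟ d

pattern first  = inj₁ refl
pattern second = inj₂ (inj₁ refl)
pattern third  = inj₂ (inj₂ (inj₁ refl))
pattern fourth = inj₂ (inj₂ (inj₂ refl))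

module _ (G : Graph) where

  private
    Vtx = Fin (n G)

  star : (c : Vtx) (Leaf : Vtx → Set) → (∀ {y} → Leaf y → Adj G c y) → Subgraph G
  star c Leaf adj = record
    { V     = λ x → x ≡ c ⊎ Leaf x
    ; E     = λ x y → (x ≡ c × Leaf y) ⊎ (y ≡ c × Leaf x)
    ; E-sym = Sum.swap
    ; E⊆G   = λ { (inj₁ (refl , ly)) → adj ly ; (inj₂ (refl , lx)) → sym G (adj lx) }
    ; E-V   = λ { (inj₁ (refl , ly)) → inj₁ refl , inj₂ ly ; (inj₂ (refl , lx)) → inj₂ lx , inj₁ refl }
    }

  star-isTree : ∀ {c Leaf} (adj : ∀ {y} → Leaf y → Adj G c y) →
                (∀ {y} → Leaf y → y ≢ c) → IsTree (star c Leaf adj)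
  star-isTree {c} {Leaf} adj leaf≢c = record
    { connected = connected-via-root (E-sym T) from-centre
    ; acyclic   = Graded.acyclic (E-sym T) height graded lower-unique
    }
    where
    T = star c Leaf adj

    from-centre : ∀ {x} → V T x → Walk (E T) c x
    from-centre (inj₁ refl) = []
    from-centre (inj₂ lx)   = inj₁ (refl , lx) ∷ []

    height : Vtx → ℕ
    height = position (c ∷ [])

    centre-below-leaf : ∀ {y} → Leaf y → suc (height c) ≡ height y
    centre-below-leaf ly = begin
      suc (height c)        ≡⟨ cong suc (position-head c []) ⟩
      1                     ≡⟨ ≡.sym (position-tail [] (leaf≢c ly)) ⟩
      height _              ∎
      where open ≡-Reasoning

    graded : ∀ {x y} → E T x y → suc (height x) ≡ height y ⊎ suc (height y) ≡ height x
    graded (inj₁ (refl , ly)) = inj₁ (centre-below-leaf ly)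
    graded (inj₂ (refl , lx)) = inj₂ (centre-below-leaf lx)

    lower-is-centre : ∀ {x z} → E T x z → suc (height x) ≡ height z → x ≡ c
    lower-is-centre (inj₁ (x≡c , _)) _ = x≡c
    lower-is-centre (inj₂ (refl , lx)) up with ≡.trans up (position-head c [])
    ... | ()

    lower-unique : ∀ {x y z} → E T x z → E T y z →
                   suc (height x) ≡ height z → suc (height y) ≡ height z → x ≡ y
    lower-unique xz yz up up′ = ≡.trans (lower-is-centre xz up) (≡.sym (lower-is-centre yz up′))

  path : (xs : List Vtx) → Linked (Adj G) xs → Subgraph G
  path xs l = record
    { V     = _∈ xs
    ; E     = Neighbours xs
    ; E-sym = Sum.swap
    ; E⊆G   = λ { (inj₁ c) → Linked-Consecutive l c ; (inj₂ c) → sym G (Linked-Consecutive l c) }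
    ; E-V   = λ { (inj₁ c) → Consecutive⇒∈ c ; (inj₂ c) → Product.swap (Consecutive⇒∈ c) }
    }

  path-isTree : ∀ {x xs} (l : Linked (Adj G) (x ∷ xs)) → Unique (x ∷ xs) → IsTree (path (x ∷ xs) l)
  path-isTree {x} {xs} l u = record
    { connected = connected-via-root (E-sym T) walk-from-head
    ; acyclic   = Graded.acyclic (E-sym T) h graded lower-unique
    }
    where
    T = path (x ∷ xs) l

    h : Vtx → ℕ
    h = position (x ∷ xs)

    graded : ∀ {a b} → E T a b → suc (h a) ≡ h b ⊎ suc (h b) ≡ h a
    graded = Sum.map (position-Consecutive u) (position-Consecutive u)

    lower-unique : ∀ {a b c} → E T a c → E T b c → suc (h a) ≡ h c → suc (h b) ≡ h c → a ≡ b
    lower-unique ac bc up up′ =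
      position-injective (proj₁ (E-V T ac)) (proj₁ (E-V T bc)) (suc-injective (≡.trans up (≡.sym up′)))

  star-edge-disjoint : ∀ {c Leaf} {adj : ∀ {y} → Leaf y → Adj G c y} (T : Subgraph G) → ¬ V T c →
                       ∀ {x y} → E T x y → E (star c Leaf adj) x y → ⊥
  star-edge-disjoint T c∉T xy (inj₁ (refl , _)) = c∉T (proj₁ (E-V T xy))
  star-edge-disjoint T c∉T xy (inj₂ (refl , _)) = c∉T (proj₂ (E-V T xy))

  InternallyDisjoint-sym : ∀ {S} {T T′ : STree G S} → InternallyDisjoint T T′ → InternallyDisjoint T′ T
  InternallyDisjoint-sym (edges , vertices) = (λ e e′ → edges e′ e) , (λ v v′ → vertices v′ v)

  κ≥3 : ∀ {S} (T₁ T₂ T₃ : STree G S) → InternallyDisjoint T₁ T₂ → InternallyDisjoint T₁ T₃ →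
        InternallyDisjoint T₂ T₃ → κ≥ G S 3
  κ≥3 {S} T₁ T₂ T₃ d₁₂ d₁₃ d₂₃ = T , disjoint
    where
    T : Fin 3 → STree G S
    T zero             = T₁
    T (suc zero)       = T₂
    T (suc (suc zero)) = T₃
    disjoint : ∀ i j → i ≢ j → InternallyDisjoint (T i) (T j)
    disjoint zero             (suc zero)       _ = d₁₂
    disjoint zero             (suc (suc zero)) _ = d₁₃
    disjoint (suc zero)       (suc (suc zero)) _ = d₂₃
    disjoint (suc zero)       zero             _ = InternallyDisjoint-sym {T = T₁} {T₂} d₁₂
    disjoint (suc (suc zero)) zero             _ = InternallyDisjoint-sym {T = T₁} {T₃} d₁₃
    disjoint (suc (suc zero)) (suc zero)       _ = InternallyDisjoint-sym {T = T₂} {T₃} d₂₃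
    disjoint zero             zero             i≢i = ⊥-elim (i≢i refl)
    disjoint (suc zero)       (suc zero)       i≢i = ⊥-elim (i≢i refl)
    disjoint (suc (suc zero)) (suc (suc zero)) i≢i = ⊥-elim (i≢i refl)

  IsK4-swap₁₂ : ∀ {a b c d} → IsK4 G a b c d → IsK4 G b a c d
  IsK4-swap₁₂ ((a≢b , a≢c , a≢d , b≢c , b≢d , c≢d) , (ab , ac , ad , bc , bd , cd)) =
    (≢-sym a≢b , b≢c , b≢d , a≢c , a≢d , c≢d) , (sym G ab , bc , bd , ac , ad , cd)

  IsK4-swap₂₃ : ∀ {a b c d} → IsK4 G a b c d → IsK4 G a c b d
  IsK4-swap₂₃ ((a≢b , a≢c , a≢d , b≢c , b≢d , c≢d) , (ab , ac , ad , bc , bd , cd)) =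
    (a≢c , a≢b , a≢d , ≢-sym b≢c , c≢d , b≢d) , (ac , ab , ad , sym G bc , cd , bd)

  IsK4-swap₃₄ : ∀ {a b c d} → IsK4 G a b c d → IsK4 G a b d c
  IsK4-swap₃₄ ((a≢b , a≢c , a≢d , b≢c , b≢d , c≢d) , (ab , ac , ad , bc , bd , cd)) =
    (a≢b , a≢d , a≢c , b≢d , b≢c , ≢-sym c≢d) , (ab , ad , ac , bd , bc , sym G cd)

  IsK4-starting-with : ∀ {a b c d u v} → IsK4 G a b c d → InFour a b c d u → InFour a b c d v → u ≢ v →
                 ∃₂ λ r s → InFour a b c d r × InFour a b c d s × IsK4 G u v r s
  IsK4-starting-with k first  second _ = _ , _ , third  , fourth , k
  IsK4-starting-with k first  third  _ = _ , _ , second , fourth , IsK4-swap₂₃ k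
  IsK4-starting-with k first  fourth _ = _ , _ , second , third  , IsK4-swap₂₃ (IsK4-swap₃₄ k)
  IsK4-starting-with k second first  _ = _ , _ , third  , fourth , IsK4-swap₁₂ k
  IsK4-starting-with k second third  _ = _ , _ , first  , fourth , IsK4-swap₂₃ (IsK4-swap₁₂ k)
  IsK4-starting-with k second fourth _ = _ , _ , first  , third  , IsK4-swap₂₃ (IsK4-swap₃₄ (IsK4-swap₁₂ k))
  IsK4-starting-with k third  first  _ = _ , _ , second , fourth , IsK4-swap₁₂ (IsK4-swap₂₃ k)
  IsK4-starting-with k third  second _ = _ , _ , first  , fourth , IsK4-swap₁₂ (IsK4-swap₂₃ (IsK4-swap₁₂ k))
  IsK4-starting-with k third  fourth _ = _ , _ , first  , second , IsK4-swap₂₃ (IsK4-swap₃₄ (IsK4-swap₁₂ (IsK4-swap₂₃ k)))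
  IsK4-starting-with k fourth first  _ = _ , _ , second , third  , IsK4-swap₁₂ (IsK4-swap₂₃ (IsK4-swap₃₄ k))
  IsK4-starting-with k fourth second _ = _ , _ , first  , third  , IsK4-swap₁₂ (IsK4-swap₂₃ (IsK4-swap₃₄ (IsK4-swap₁₂ k)))
  IsK4-starting-with k fourth third  _ = _ , _ , first  , second , IsK4-swap₁₂ (IsK4-swap₂₃ (IsK4-swap₃₄ (IsK4-swap₁₂ (IsK4-swap₂₃ k))))
  IsK4-starting-with k first  first  a≢a = ⊥-elim (a≢a refl)
  IsK4-starting-with k second second b≢b = ⊥-elim (b≢b refl)
  IsK4-starting-with k third  third  c≢c = ⊥-elim (c≢c refl)
  IsK4-starting-with k fourth fourth d≢d = ⊥-elim (d≢d refl)

  module _ {a b c d : Vtx} where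

    private
      K : Vtx → Set
      K = InFour a b c d

    κ≥3-from-K4-path : ∀ {p q r s} → IsK4 G p q r s → K p → K q → K r → K s →
                  ∀ M → Linked (AdjMinusK G a b c d) (p ∷ M) → Unique (p ∷ M) →
                  q ∈ M → All (λ x → K x → x ≡ q) M → κ≥ G (Three p q r) 3
    κ≥3-from-K4-path {p} {q} {r} {s} ((p≢q , p≢r , p≢s , q≢r , q≢s , r≢s) , (pq , pr , ps , qr , qs , rs))
                kp kq kr ks M trail uniq q∈M only-q =
      κ≥3 T₁ T₂ T₃ (edges₁₂ , λ v _ → T₁⊆S v) (edges₁₃ , λ v _ → T₁⊆S v) (edges₂₃ , vertices₂₃)
      where
      S : Vtx → Set
      S = Three p q r

      S⊆K : ∀ {x} → S x → K x
      S⊆K (inj₁ refl)        = kp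
      S⊆K (inj₂ (inj₁ refl)) = kq
      S⊆K (inj₂ (inj₂ refl)) = kr

      s∉S : ¬ S s
      s∉S (inj₁ s≡p)        = p≢s (≡.sym s≡p)
      s∉S (inj₂ (inj₁ s≡q)) = q≢s (≡.sym s≡q)
      s∉S (inj₂ (inj₂ s≡r)) = r≢s (≡.sym s≡r)

      K∉M : ∀ {x} → K x → x ≢ q → x ∉ M
      K∉M kx x≢q x∈M = x≢q (All.lookup only-q x∈M kx)

      q-adj : ∀ {x} → x ≡ p ⊎ x ≡ r → Adj G q x
      q-adj (inj₁ refl) = sym G pq
      q-adj (inj₂ refl) = qr

      T₁ : STree G S
      T₁ = record
        { tree   = star q (λ x → x ≡ p ⊎ x ≡ r) q-adj
        ; isTree = star-isTree q-adj λ { (inj₁ refl) → p≢q ; (inj₂ refl) → ≢-sym q≢r }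
        ; S⊆V    = λ { (inj₁ x≡p) → inj₂ (inj₁ x≡p) ; (inj₂ (inj₁ x≡q)) → inj₁ x≡q ; (inj₂ (inj₂ x≡r)) → inj₂ (inj₂ x≡r) }
        }

      T₁⊆S : ∀ {x} → V (tree T₁) x → S x
      T₁⊆S (inj₁ x≡q)        = inj₂ (inj₁ x≡q)
      T₁⊆S (inj₂ (inj₁ x≡p)) = inj₁ x≡p
      T₁⊆S (inj₂ (inj₂ x≡r)) = inj₂ (inj₂ x≡r)

      s-adj : ∀ {x} → S x → Adj G s x
      s-adj (inj₁ refl)        = sym G ps
      s-adj (inj₂ (inj₁ refl)) = sym G qs
      s-adj (inj₂ (inj₂ refl)) = sym G rs

      T₂ : STree G S
      T₂ = record
        { tree   = star s S s-adj
        ; isTree = star-isTree s-adj λ Sx x≡s → s∉S (≡.subst S x≡s Sx)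
        ; S⊆V    = inj₂
        }

      r∉ : r ∉ p ∷ M
      r∉ (here r≡p)  = p≢r (≡.sym r≡p)
      r∉ (there r∈M) = K∉M kr (≢-sym q≢r) r∈M

      T₃ : STree G S
      T₃ = record
        { tree   = path (r ∷ p ∷ M) (sym G pr ∷ Linked.map proj₁ trail)
        ; isTree = path-isTree _ (¬Any⇒All¬ _ r∉ ∷ uniq)
        ; S⊆V    = λ { (inj₁ refl) → there (here refl) ; (inj₂ (inj₁ refl)) → there (there q∈M) ; (inj₂ (inj₂ refl)) → here refl }
        }

      s∉T₃ : ¬ V (tree T₃) s
      s∉T₃ (here s≡r)          = r≢s (≡.sym s≡r)
      s∉T₃ (there (here s≡p))  = p≢s (≡.sym s≡p)
      s∉T₃ (there (there s∈M)) = K∉M ks (≢-sym q≢s) s∈M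

      edges₁₂ : ∀ {x y} → E (tree T₁) x y → E (tree T₂) x y → ⊥
      edges₁₂ = star-edge-disjoint {adj = s-adj} (tree T₁) (s∉S ∘ T₁⊆S)

      -- the only edge of T₃ inside K is rp, which avoids q
      T₃-edge : ∀ {x y} → E (tree T₃) x y → K x → K y → x ≢ q × y ≢ q
      T₃-edge (inj₁ here)      _  _  = ≢-sym q≢r , p≢q
      T₃-edge (inj₂ here)      _  _  = p≢q , ≢-sym q≢r
      T₃-edge (inj₁ (there c)) kx ky = ⊥-elim (proj₂ (Linked-Consecutive trail c) (kx , ky))
      T₃-edge (inj₂ (there c)) kx ky = ⊥-elim (proj₂ (Linked-Consecutive trail c) (ky , kx))

      edges₁₃ : ∀ {x y} → E (tree T₁) x y → E (tree T₃) x y → ⊥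
      edges₁₃ xy₁ xy₃ with E-V (tree T₁) xy₁
      ... | vx , vy with T₃-edge xy₃ (S⊆K (T₁⊆S vx)) (S⊆K (T₁⊆S vy)) | xy₁
      ...   | x≢q , _ | inj₁ (x≡q , _) = x≢q x≡q
      ...   | _ , y≢q | inj₂ (y≡q , _) = y≢q y≡q

      edges₂₃ : ∀ {x y} → E (tree T₂) x y → E (tree T₃) x y → ⊥
      edges₂₃ xy₂ xy₃ = star-edge-disjoint {adj = s-adj} (tree T₃) s∉T₃ xy₃ xy₂

      vertices₂₃ : ∀ {x} → V (tree T₂) x → V (tree T₃) x → S x
      vertices₂₃ (inj₁ refl) v₃ = ⊥-elim (s∉T₃ v₃)
      vertices₂₃ (inj₂ Sx)   _  = Sx

lemma1 : (G : Graph) (a b c d : Fin (n G)) → IsK4 G a b c d →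
    (u v : Fin (n G)) → InFour a b c d u → InFour a b c d v → u ≢ v →
    Path (AdjMinusK G a b c d) u v →
    κ̄₃≥ G 3
lemma1 G a b c d k4 u v u∈K v∈K u≢v ([] , _) = ⊥-elim (u≢v refl)
lemma1 G a b c d k4 u v u∈K v∈K u≢v (e ∷ w , uniq)
  with firstHit (InFour? a b c d) (Walk⇒Linked (e ∷ w)) (lose (target∈walkVerts w) v∈K)
... | M , q , trail , M⊆ , q∈M , q∈K , only-q
  with Unique-resp-⊆ (refl ∷ M⊆) uniq
...   | uniq′@(u∉M ∷ _)
  with IsK4-starting-with G k4 u∈K q∈K (All.lookup u∉M q∈M)
...     | r , s , r∈K , s∈K , k4′@((u≢q , u≢r , _ , q≢r , _) , _) =
  u , q , r , u≢q , u≢r , q≢r , κ≥3-from-K4-path G k4′ u∈K q∈K r∈K s∈K M trail uniq′ q∈M only-q
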